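{- Let $j\geq \chi\geq 2$ and $n\geq 2$ be integers. If $H$ is a graph with chromatic number $\chi$ and $G$ is a connected graph on $n$ vertices, then \[ m_j(H,G)\geq \Big\lfloor \frac{n-1}{\lceil \frac{j}{\chi-1}\rceil}\Big\rfloor+1 . \]
   Context: All graphs are simple. For integers $j\geq 2$ and $t\geq 1$, $K_{j\times t}$ denotes the complete multipartite graph with $j$ parts, each of size $t$. For graphs $H$ and $G$, the size multipartite Ramsey number $m_j(H,G)$ is the smallest natural number $t$ such that every coloring of the edges of $K_{j\times t}$ with two colors red and blue contains a red copy of $H$ or a blue copy of $G$ as a subgraph. -}

module Defs where

open import Data.Nat using (ℕ; zero; suc; _+_; _/_; _≤_; _<_)
open import Data.Fin using (Fin)
open import Data.Bool using (Bool; true; false; T; not)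
open import Data.Sum using (_⊎_)
open import Data.Product using (Σ; _×_; _,_; proj₁; proj₂)
open import Relation.Binary.PropositionalEquality using (_≡_; _≢_)
open import Function.Definitions using (Injective)
open import Relation.Nullary using (¬_)

record Graph (n : ℕ) : Set where
  field
    adj    : Fin n → Fin n → Bool
    sym    : ∀ u v → adj u v ≡ adj v u
    irrefl : ∀ v → adj v v ≡ false
open Graph public

ProperColouring : ∀ {h} → Graph h → (k : ℕ) → (Fin h → Fin k) → Set
ProperColouring H k col = ∀ u v → T (adj H u v) → col u ≢ col v

Colourable : ∀ {h} → Graph h → ℕ → Set
Colourable {h} H k = Σ (Fin h → Fin k) (ProperColouring H k)

HasChromaticNumber : ∀ {h} → Graph h → ℕ → Set
HasChromaticNumber H χ = Colourable H χ × (∀ k → k < χ → ¬ Colourable H k)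

data Walk {n : ℕ} (G : Graph n) : Fin n → Fin n → Set where
  here : ∀ {u} → Walk G u u
  step : ∀ {u w v} → T (adj G u w) → Walk G w v → Walk G u v

Connected : ∀ {n} → Graph n → Set
Connected G = ∀ u v → Walk G u v

-- complete multipartite graph K_{j×t}: vertices (part, index), adjacent iff
-- in different parts
Vtx : ℕ → ℕ → Set
Vtx j t = Fin j × Fin t

KAdj : ∀ {j t} → Vtx j t → Vtx j t → Set
KAdj x y = proj₁ x ≢ proj₁ y

data Colour : Set where
  red blue : Colour

-- a 2-colouring of the edges of K_{j×t}: a colour for every (unordered) pair
-- of adjacent vertices, given symmetrically on ordered pairs
record EdgeColouring (j t : ℕ) : Set where
  field
    colour    : Vtx j t → Vtx j t → Colour
    colourSym : ∀ x y → colour x y ≡ colour y x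
open EdgeColouring public

MonoCopy : ∀ {j t f} → EdgeColouring j t → Colour → Graph f → Set
MonoCopy {j} {t} {f} C c F =
  Σ (Fin f → Vtx j t) λ φ →
    Injective _≡_ _≡_ φ ×
    (∀ u v → T (adj F u v) → KAdj (φ u) (φ v) × colour C (φ u) (φ v) ≡ c)

Arrows : ∀ {h n} → ℕ → ℕ → Graph h → Graph n → Set
Arrows j t H G = ∀ (C : EdgeColouring j t) → MonoCopy C red H ⊎ MonoCopy C blue G

-- m_j(H,G) ≥ L : no t with 1 ≤ t < L has the arrowing property
-- (m_j(H,G) is the least t ≥ 1 with Arrows j t H G)
SizeMultipartiteRamsey≥ : ∀ {h n} → ℕ → Graph h → Graph n → ℕ → Set
SizeMultipartiteRamsey≥ j H G L = ∀ t → 1 ≤ t → t < L → ¬ Arrows j t H G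

-- ceiling and floor division (denominator 0 gives 0; unused below)
⌊_/_⌋ : ℕ → ℕ → ℕ
⌊ a / zero ⌋ = 0
⌊ a / suc b ⌋ = a / suc b

⌈_/_⌉ : ℕ → ℕ → ℕ
⌈ a / zero ⌉ = 0
⌈ a / suc b ⌉ = (a + b) / suc b

{-# OPTIONS --safe #-}
module Submission where

-- Let k = ⌈j/(χ-1)⌉ and split the j parts of K_{j×t} into χ-1 blocks of at
-- most k consecutive parts.  Colour an edge blue inside a block and red
-- between blocks.  The red graph is then (χ-1)-partite, so it contains no
-- graph of chromatic number χ.  A blue copy of a connected graph stays inside
-- one block, which has at most k·t vertices; so for k·t < n there is no blue
-- copy of G, and k·t < n holds for every t ≤ ⌊(n-1)/k⌋.

open import Defs
open import Data.Nat using (ℕ; zero; suc; _+_; _∸_; _*_; _≤_; _<_; _/_; _%_; s≤s; NonZero)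
open import Data.Nat.Properties
open import Data.Nat.DivMod
open import Data.Fin using (Fin; toℕ; fromℕ<; combine)
open import Data.Fin.Properties using (toℕ<n; fromℕ<-injective; toℕ-injective; combine-injective; injective⇒≤)
open import Data.Product using (_,_; proj₁; proj₂)
open import Data.Product.Properties using (×-≡,≡→≡)
open import Data.Sum using (inj₁; inj₂)
open import Function using (_∘_)
open import Relation.Nullary using (¬_; yes; no; contradiction)
open import Relation.Binary.PropositionalEquality
  using (_≡_; _≢_; refl; cong; cong₂; trans; subst; module ≡-Reasoning)
  renaming (sym to ≡-sym)

m≤n*⌈m/n⌉ : ∀ m n .{{_ : NonZero n}} → m ≤ n * ⌈ m / n ⌉
m≤n*⌈m/n⌉ m (suc c) = +-cancelʳ-≤ c m _ (begin
  m + c                       ≡⟨ m≡m%n+[m/n]*n (m + c) (suc c) ⟩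
  (m + c) % suc c + q * suc c ≤⟨ +-monoˡ-≤ _ (m<1+n⇒m≤n (m%n<n (m + c) (suc c))) ⟩
  c + q * suc c               ≡⟨ +-comm c _ ⟩
  q * suc c + c               ≡⟨ cong (_+ c) (*-comm q (suc c)) ⟩
  suc c * q + c               ∎)
  where
  open ≤-Reasoning
  q : ℕ
  q = (m + c) / suc c

m<⌊n/o⌋+1⇒m*o≤n : ∀ {m n o} .{{_ : NonZero o}} → m < ⌊ n / o ⌋ + 1 → m * o ≤ n
m<⌊n/o⌋+1⇒m*o≤n {m} {n} {suc o} m<n/o+1 = ≤-trans (*-monoˡ-≤ (suc o) m≤n/o) (m/n*n≤m n (suc o))
  where
  m≤n/o : m ≤ n / suc o
  m≤n/o = m<1+n⇒m≤n (subst (m <_) (+-comm (n / suc o) 1) m<n/o+1)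

classColour : ℕ → ℕ → Colour
classColour a b with a ≟ b
... | yes _ = blue
... | no _  = red

classColour-sym : ∀ a b → classColour a b ≡ classColour b a
classColour-sym a b with a ≟ b | b ≟ a
... | yes _   | yes _   = refl
... | no _    | no _    = refl
... | yes a≡b | no b≢a  = contradiction (≡-sym a≡b) b≢a
... | no a≢b  | yes b≡a = contradiction (≡-sym b≡a) a≢b

red-classColour⇒≢ : ∀ {a b} → classColour a b ≡ red → a ≢ b
red-classColour⇒≢ {a} {b} _ with a ≟ b
... | no a≢b = a≢b

blue-classColour⇒≡ : ∀ {a b} → classColour a b ≡ blue → a ≡ b
blue-classColour⇒≡ {a} {b} _ with a ≟ b
... | yes a≡b = a≡b

classColouring : ∀ {j t} → (Vtx j t → ℕ) → EdgeColouring j t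
classColouring class = record
  { colour    = λ x y → classColour (class x) (class y)
  ; colourSym = λ x y → classColour-sym (class x) (class y)
  }

red-copy⇒colourable : ∀ {j t h c} (class : Vtx j t → ℕ) → (∀ x → class x < c) →
  (H : Graph h) → MonoCopy (classColouring class) red H → Colourable H c
red-copy⇒colourable {h = h} {c} class class<c H (φ , _ , edge) = colourOf , proper
  where
  colourOf : Fin h → Fin c
  colourOf u = fromℕ< (class<c (φ u))

  proper : ProperColouring H c colourOf
  proper u v uv sameColour = red-classColour⇒≢ (proj₂ (edge u v uv))
    (fromℕ<-injective _ _ (class<c (φ u)) (class<c (φ v)) sameColour)

blue-copy-preserves-class : ∀ {j t n} (class : Vtx j t → ℕ) {G : Graph n}
  (copy : MonoCopy (classColouring class) blue G) →
  ∀ {u v} → Walk G u v → class (proj₁ copy u) ≡ class (proj₁ copy v)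
blue-copy-preserves-class class copy here = refl
blue-copy-preserves-class class copy@(_ , _ , edge) (step {u} {w} uw walk) =
  trans (blue-classColour⇒≡ (proj₂ (edge u w uw))) (blue-copy-preserves-class class copy walk)

blue-connected-copy⇒≤ : ∀ {j t n m} (class : Vtx j t → ℕ) (offset : Vtx j t → Fin m) →
  (∀ {x y} → class x ≡ class y → offset x ≡ offset y → x ≡ y) →
  {G : Graph n} → Connected G → MonoCopy (classColouring class) blue G → n ≤ m
blue-connected-copy⇒≤ class offset offset-injective connected copy@(φ , φ-injective , _) =
  injective⇒≤ {f = offset ∘ φ} λ {u} {v} →
    φ-injective ∘ offset-injective (blue-copy-preserves-class class copy (connected u v))

m%o≡n%o⇒m/o≡n/o⇒m≡n : ∀ {m n o} .{{_ : NonZero o}} → m % o ≡ n % o → m / o ≡ n / o → m ≡ n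
m%o≡n%o⇒m/o≡n/o⇒m≡n {m} {n} {o} sameRem sameQuot = begin
  m                 ≡⟨ m≡m%n+[m/n]*n m o ⟩
  m % o + m / o * o ≡⟨ cong₂ (λ r q → r + q * o) sameRem sameQuot ⟩
  n % o + n / o * o ≡⟨ m≡m%n+[m/n]*n n o ⟨
  n                 ∎
  where open ≡-Reasoning

module Blocks (k : ℕ) .{{_ : NonZero k}} {j t : ℕ} where

  block : Vtx j t → ℕ
  block (i , _) = toℕ i / k

  offset : Vtx j t → Fin (t * k)
  offset (i , a) = combine a (toℕ i mod k)

  block< : ∀ {c} → j ≤ c * k → ∀ x → block x < c
  block< j≤ck (i , _) = m<n*o⇒m/o<n (≤-trans (toℕ<n i) j≤ck)

  offset-injective-within-block : ∀ {x y} → block x ≡ block y → offset x ≡ offset y → x ≡ y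
  offset-injective-within-block {i , a} {i′ , a′} sameBlock sameOffset
    with combine-injective a (toℕ i mod k) a′ (toℕ i′ mod k) sameOffset
  ... | a≡a′ , sameMod = ×-≡,≡→≡ (toℕ-injective (m%o≡n%o⇒m/o≡n/o⇒m≡n sameRem sameBlock) , a≡a′)
    where
    sameRem : toℕ i % k ≡ toℕ i′ % k
    sameRem = fromℕ<-injective _ _ (m%n<n (toℕ i) k) (m%n<n (toℕ i′) k) sameMod

  ¬Arrows : ∀ {h n c} (H : Graph h) (G : Graph n) → j ≤ c * k → ¬ Colourable H c →
    t * k < n → Connected G → ¬ Arrows j t H G
  ¬Arrows H G j≤ck uncolourable tk<n connected arrows with arrows (classColouring block)
  ... | inj₁ redH  = uncolourable (red-copy⇒colourable block (block< j≤ck) H redH)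
  ... | inj₂ blueG = <⇒≱ tk<n
    (blue-connected-copy⇒≤ block offset offset-injective-within-block connected blueG)

theorem2 : (j χ n h : ℕ) → 2 ≤ χ → χ ≤ j → 2 ≤ n →
    (H : Graph h) → (G : Graph n) →
    HasChromaticNumber H χ → Connected G →
    SizeMultipartiteRamsey≥ j H G (⌊ n ∸ 1 / ⌈ j / χ ∸ 1 ⌉ ⌋ + 1)
theorem2 j (suc (suc c)) (suc n′) h (s≤s (s≤s _)) _ (s≤s _) H G (_ , uncolourable) connected t 1≤t t<L
  with ⌈ j / suc c ⌉ | m≤n*⌈m/n⌉ j (suc c)
  -- k = 0 only for j = 0, where ⌊(n-1)/0⌋ = 0 leaves no t in range
... | zero   | _    = contradiction 1≤t (<⇒≱ t<L)
... | suc k′ | j≤ck = Blocks.¬Arrows (suc k′) H G j≤ck (uncolourable (suc c) ≤-refl)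
  (s≤s (m<⌊n/o⌋+1⇒m*o≤n t<L)) connected
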